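{- Let $m>1$ and $n\in\mathbb N_0$, and write $n=a_0+a_1m+\dots+a_sm^s$ with $0\le a_j\le m-1$ for $j=0,\dots,s$. Then $$\overline{b}_m(mn)\equiv\prod_{j=0}^{s}(2a_j+1)\pmod m.$$
   Context: The sequence $(\overline{b}_m(n))_{n\in\mathbb N_0}$ is defined by $\overline{b}_m(0)=1$, $\overline{b}_m(mn)=\overline{b}_m(mn+1)=\dots=\overline{b}_m(mn+m-1)$ for $n\ge0$, and $\overline{b}_m(mn)-\overline{b}_m(mn-1)=\overline{b}_m(n)+\overline{b}_m(n-1)$ for $n\ge1$. -}

module Defs where

open import Data.Nat using (ℕ; zero; suc; _+_; _*_; _∸_; _≤_; _<_)
open import Data.List using (List; []; _∷_)
open import Data.List.Relation.Unary.All using (All)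
open import Relation.Binary.PropositionalEquality using (_≡_)

-- The defining conditions of the sequence b̄_m (as in the paper):
--   b̄_m(0) = 1,
--   b̄_m(mn) = b̄_m(mn+r) for 0 ≤ r ≤ m-1,
--   b̄_m(mn) - b̄_m(mn-1) = b̄_m(n) + b̄_m(n-1) for n ≥ 1
-- (the last written additively over ℕ: b̄_m(m(n+1)) = b̄_m(m(n+1)-1) + b̄_m(n+1) + b̄_m(n)).
record IsBbar (m : ℕ) (b : ℕ → ℕ) : Set where
  field
    base  : b 0 ≡ 1
    const : ∀ n r → r < m → b (m * n + r) ≡ b (m * n)
    step  : ∀ n → b (m * suc n) ≡ b (m * suc n ∸ 1) + b (suc n) + b n

digitsValue : ℕ → List ℕ → ℕ
digitsValue m []       = 0
digitsValue m (a ∷ as) = a + m * digitsValue m as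

oddProd : List ℕ → ℕ
oddProd []       = 1
oddProd (a ∷ as) = (2 * a + 1) * oddProd as

{-# OPTIONS --safe #-}
module Submission where

-- Write B q = b̄(mq). Unfolding the recursion across one block of m equal values gives
-- B(mq + r) = B(mq) + 2r B(q) for r < m, and B(m(q+1)) = B(mq + m - 1) + B(q+1) + B(q),
-- so B(m(q+1)) - B(q+1) ≡ B(mq) - B(q) (mod m) and hence B(mq) ≡ B(q) (mod m) for all q.
-- Peeling off the lowest digit a of n = a + m n′ then gives B(n) ≡ (2a + 1) B(n′) (mod m).

open import Defs
open import Data.Nat using (ℕ; zero; suc; _+_; _*_; _∸_; _<_; _%_; NonZero)
open import Data.Nat.Properties
open import Data.Nat.DivMod using ([m+kn]%n≡m%n)
open import Data.Nat.Tactic.RingSolver using (solve-∀)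
open import Data.List using (List; []; _∷_)
open import Data.List.Relation.Unary.All using (All; []; _∷_)
open import Data.Product using (Σ-syntax; _,_)
open import Relation.Binary.PropositionalEquality
open ≡-Reasoning

-- Congruence mod m, witnessed one-sidedly so that no truncated subtraction is needed.
_≡_+multipleOf_ : ℕ → ℕ → ℕ → Set
x ≡ y +multipleOf m = Σ[ c ∈ ℕ ] x ≡ y + m * c

≡+multipleOf⇒%≡ : ∀ {x} y m .{{_ : NonZero m}} → x ≡ y +multipleOf m → x % m ≡ y % m
≡+multipleOf⇒%≡ y m (c , refl) =
  trans (cong (λ z → (y + z) % m) (*-comm m c)) ([m+kn]%n≡m%n y c m)

module _ (k : ℕ) (b : ℕ → ℕ) (isBbar : IsBbar (suc k) b) where
  open IsBbar isBbar

  m : ℕ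
  m = suc k

  B : ℕ → ℕ
  B q = b (m * q)

  B-suc : ∀ j → B (suc j) ≡ B j + b (suc j) + b j
  B-suc j = begin
    b (m * suc j)                       ≡⟨ step j ⟩
    b (m * suc j ∸ 1) + b (suc j) + b j ≡⟨ cong (λ x → b x + b (suc j) + b j) m*suc∸1 ⟩
    b (m * j + k) + b (suc j) + b j     ≡⟨ cong (λ x → x + b (suc j) + b j) (const j k ≤-refl) ⟩
    B j + b (suc j) + b j               ∎
    where
    m*suc∸1 : m * suc j ∸ 1 ≡ m * j + k
    m*suc∸1 = begin
      j + k * suc j   ≡⟨ cong (j +_) (trans (*-suc k j) (+-comm k (k * j))) ⟩
      j + (k * j + k) ≡⟨ +-assoc j (k * j) k ⟨
      m * j + k       ∎

  B-suc-inBlock : ∀ q i → i < m → B (suc (m * q + i)) ≡ B (m * q + i) + b (suc (m * q + i)) + B q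
  B-suc-inBlock q i i<m = trans (B-suc (m * q + i)) (cong (λ x → B (m * q + i) + b (suc (m * q + i)) + x) (const q i i<m))

  B-inBlock : ∀ q r → r < m → B (m * q + r) ≡ B (m * q) + (r + r) * B q
  B-inBlock q zero    _   = trans (cong B (+-identityʳ (m * q))) (sym (+-identityʳ _))
  B-inBlock q (suc r) r<m = begin
    B (m * q + suc r)                       ≡⟨ cong B (+-suc (m * q) r) ⟩
    B (suc (m * q + r))                     ≡⟨ B-suc-inBlock q r r<m′ ⟩
    B (m * q + r) + b (suc (m * q + r)) + B q
      ≡⟨ cong (λ x → B (m * q + r) + x + B q) (trans (cong b (sym (+-suc (m * q) r))) (const q (suc r) r<m)) ⟩
    B (m * q + r) + B q + B q               ≡⟨ cong (λ x → x + B q + B q) (B-inBlock q r r<m′) ⟩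
    B (m * q) + (r + r) * B q + B q + B q   ≡⟨ collect (B (m * q)) r (B q) ⟩
    B (m * q) + (suc r + suc r) * B q       ∎
    where
    r<m′ : r < m
    r<m′ = <-trans (n<1+n r) r<m
    collect : ∀ x r y → x + (r + r) * y + y + y ≡ x + (suc r + suc r) * y
    collect = solve-∀

  B-m*suc : ∀ q → B (m * suc q) ≡ B (m * q) + (k + k) * B q + B (suc q) + B q
  B-m*suc q = begin
    B (m * suc q)                                ≡⟨ cong B lastInBlock ⟨
    B (suc (m * q + k))                          ≡⟨ B-suc-inBlock q k ≤-refl ⟩
    B (m * q + k) + b (suc (m * q + k)) + B q    ≡⟨ cong (λ x → B (m * q + k) + b x + B q) lastInBlock ⟩
    B (m * q + k) + B (suc q) + B q              ≡⟨ cong (λ x → x + B (suc q) + B q) (B-inBlock q k ≤-refl) ⟩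
    B (m * q) + (k + k) * B q + B (suc q) + B q  ∎
    where
    lastInBlock : suc (m * q + k) ≡ m * suc q
    lastInBlock = trans (sym (+-suc (m * q) k)) (trans (+-comm (m * q) m) (sym (*-suc m q)))

  B-m* : ∀ q → B (m * q) ≡ B q +multipleOf m
  B-m* zero = 0 , trans (sym (+-identityʳ _)) (cong₂ _+_ (cong B (*-zeroʳ m)) (sym (*-zeroʳ m)))
  B-m* (suc q) with B-m* q
  ... | c , B-mq = c + (B q + B q) , (begin
    B (m * suc q)                                    ≡⟨ B-m*suc q ⟩
    B (m * q) + (k + k) * B q + B (suc q) + B q      ≡⟨ cong (λ x → x + (k + k) * B q + B (suc q) + B q) B-mq ⟩
    B q + m * c + (k + k) * B q + B (suc q) + B q    ≡⟨ collect k (B q) c (B (suc q)) ⟩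
    B (suc q) + m * (c + (B q + B q))                ∎)
    where
    collect : ∀ k y c z → y + suc k * c + (k + k) * y + z + y ≡ z + suc k * (c + (y + y))
    collect = solve-∀

  B-digitsValue : ∀ as → All (_< m) as → B (digitsValue m as) ≡ oddProd as +multipleOf m
  B-digitsValue [] [] = 0 , trans (cong b (*-zeroʳ m)) (trans base (cong (1 +_) (sym (*-zeroʳ m))))
  B-digitsValue (a ∷ as) (a<m ∷ as<m) with B-digitsValue as as<m | B-m* (digitsValue m as)
  ... | d , B-v | c , B-mv = (2 * a + 1) * d + c , (begin
    B (a + m * v)                                ≡⟨ cong B (+-comm a (m * v)) ⟩
    B (m * v + a)                                ≡⟨ B-inBlock v a a<m ⟩
    B (m * v) + (a + a) * B v                    ≡⟨ cong (λ x → x + (a + a) * B v) B-mv ⟩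
    B v + m * c + (a + a) * B v                  ≡⟨ cong (λ x → x + m * c + (a + a) * x) B-v ⟩
    P + m * d + m * c + (a + a) * (P + m * d)    ≡⟨ collect k a c P d ⟩
    (2 * a + 1) * P + m * ((2 * a + 1) * d + c)  ∎)
    where
    v = digitsValue m as
    P = oddProd as
    collect : ∀ k a c P d → P + suc k * d + suc k * c + (a + a) * (P + suc k * d)
                          ≡ (2 * a + 1) * P + suc k * ((2 * a + 1) * d + c)
    collect = solve-∀

corollary7 : (m : ℕ) → .{{_ : NonZero m}} → 1 < m → (b : ℕ → ℕ) → IsBbar m b →
    (n : ℕ) → (as : List ℕ) → All (λ a → a < m) as → digitsValue m as ≡ n →
    b (m * n) % m ≡ oddProd as % m
corollary7 (suc k) _ b isBbar _ as as<m refl =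
  ≡+multipleOf⇒%≡ (oddProd as) (suc k) (B-digitsValue k b isBbar as as<m)
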